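{- Define an infinite sequence $\mathbf{v} = a(0)a(1)a(2)\cdots$ over $\mathbb{N}=\{0,1,2,\ldots\}$ by, for all $n \geq 0$: $a(10n) = a(10n+3) = a(10n+6) = 0$; $a(10n+1) = a(10n+5) = a(10n+8) = 1$; $a(10n+2) = a(10n+7) = 2$; $a(10n+4) = 3$ if $n \equiv 0 \pmod 2$ and $a(10n+4)=4$ if $n \equiv 1 \pmod 2$; $a(10n+9) = 3$ if $n \equiv 0 \pmod 3$, $a(10n+9)=4$ if $n \equiv 1 \pmod 3$, and $a(10n+9) = a(5(n-2)/3 + 4) + 2$ if $n \equiv 2 \pmod 3$. Then $\mathbf{v}$ avoids $\tfrac{3}{2}$-powers, and it is the lexicographically least infinite word over $\mathbb{N}$ avoiding $\tfrac{3}{2}$-powers; that is, $\mathbf{v} = \mathbf{w}_{3/2}$.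
   Context: For integers $p > q \geq 1$, a finite word $x$ is a $p/q$-power if $x = y^e y'$ for some nonempty word $y$, some integer $e \geq 1$, and some prefix $y'$ of $y$, with $|x|/|y| = p/q$. An infinite word avoids $\tfrac{3}{2}$-powers if it has no factor that is an $\alpha$-power for any rational $\alpha \geq 3/2$. Words over $\mathbb{N}$ are compared lexicographically using the usual order on $\mathbb{N}$; $\mathbf{w}_{3/2}$ denotes the lexicographically least infinite word over $\mathbb{N}$ avoiding $\tfrac{3}{2}$-powers. -}

module Defs where

open import Data.Nat using (ℕ; zero; suc; _+_; _*_; _∸_; _<_; _≤_)
open import Data.Nat.DivMod using (_/_; _%_)
open import Data.Product using (Σ; _×_; _,_)
open import Data.Empty using (⊥)
open import Relation.Binary.PropositionalEquality using (_≡_)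

Word : Set
Word = ℕ → ℕ

-- One unfolding step of the defining recurrence of the sequence a, with
-- m = 10n + r (n = m / 10, r = m % 10); g is used for the recursive call.
-- In the case r = 9, n ≡ 2 (mod 3), we have (n-2)/3 = n/3 (floor division),
-- so the recursive index 5(n-2)/3 + 4 is 5 * (n / 3) + 4.
step : (ℕ → ℕ) → ℕ → ℕ
step g m = go (m % 10)
  where
  n : ℕ
  n = m / 10
  case4 : ℕ → ℕ
  case4 zero = 3
  case4 (suc _) = 4
  case9 : ℕ → ℕ
  case9 0 = 3
  case9 1 = 4
  case9 _ = g (5 * (n / 3) + 4) + 2
  go : ℕ → ℕ
  go 0 = 0
  go 1 = 1
  go 2 = 2
  go 3 = 0
  go 4 = case4 (n % 2)
  go 5 = 1
  go 6 = 0
  go 7 = 2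
  go 8 = 1
  go _ = case9 (n % 3)

-- Fuel-bounded iteration; the recursive index 5*(n/3)+4 is strictly less than
-- 10n+9, so fuel m+1 suffices to compute a(m).
aFuel : ℕ → ℕ → ℕ
aFuel zero m = 0
aFuel (suc f) m = step (aFuel f) m

v : Word
v m = aFuel (suc m) m

HasPeriod : Word → ℕ → ℕ → ℕ → Set
HasPeriod w i L p = (j : ℕ) → j < L ∸ p → w (i + j) ≡ w (i + j + p)

-- The factor of w of length L starting at i is an α-power with α = L/p ≥ 3/2
-- (for the nonempty period y of length p): 1 ≤ p, 3p ≤ 2L, and period p.
-- (Then x = y^e y' with |y| = p, e = ⌊L/p⌋ ≥ 1, y' a prefix of y.)
ThreeHalvesPowerAt : Word → ℕ → ℕ → Set
ThreeHalvesPowerAt w i L = Σ ℕ λ p → (1 ≤ p) × (3 * p ≤ 2 * L) × HasPeriod w i L p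

Avoids32 : Word → Set
Avoids32 w = (i L : ℕ) → ThreeHalvesPowerAt w i L → ⊥

_<lex_ : Word → Word → Set
u <lex w = Σ ℕ λ k → ((j : ℕ) → j < k → u j ≡ w j) × (u k < w k)

module Submission where

open import Defs
open import Data.Nat
open import Data.Nat.Properties
open import Data.Nat.DivMod
open import Data.Nat.Divisibility using (divides)
open import Data.Nat.Induction using (<-rec)
open import Data.Nat.Tactic.RingSolver using (solve-∀)
open import Data.Product using (∃; _×_; _,_; proj₁; proj₂)
open import Data.Sum using (inj₁; inj₂)
open import Data.Empty using (⊥)
open import Relation.Nullary using (¬_; yes; no; contradiction)
open import Relation.Nullary.Decidable using (from-yes; _×-dec_; _→-dec_; ¬?)
open import Relation.Binary.PropositionalEquality
open import Function using (id)

-- Write b(k) = v(5k + 4).  Off the positions ≡ 4 (mod 5) the letters of v are at most 2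
-- and follow a 10-periodic pattern σ; the letters of b are at least 3 and satisfy
--   b(4t) = 3,  b(4t+2) = 4,  b(6t+1) = 3,  b(6t+3) = 4,  b(6t+5) = b(t) + 2.
-- So, capped at 3 resp. 5, the words v and b are periodic (periods 10 and 12), and both
-- are "layered": v over b with blocks of 5, b over itself (letters + 2) with blocks of 6,
-- the block ends carrying the inner word and the other letters being periodic.  Then:
--  * b has no 3/2-power of even period 2q: for q ≡ 0 (mod 6) it restricts to a shorter
--    one, otherwise the capped pattern of b refutes it.  Hence v avoids 3/2-powers: a
--    period ≡ 0 (mod 10) restricts to an even-period power of b, any other period is
--    refuted by σ.
--  * Every letter c < v(k) completes a "near-power" of v ending at k: inside one block
--    if c is small, and by lifting from b (by induction on k) if c ≥ 3.  So a word that
--    first drops below v at position k contains a 3/2-power.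
-- Finitely many facts about the patterns σ and τ are checked by computation.

data Block (n : ℕ) : ℕ → Set where
  block : (r q : ℕ) → r < n → Block n (r + q * n)

blocks : ∀ n .{{_ : NonZero n}} k → Block n k
blocks n k = subst (Block n) (sym (m≡m%n+[m/n]*n k n)) (block (k % n) (k / n) (m%n<n k n))

residue : ∀ {r} q n .{{_ : NonZero n}} → r < n → (r + q * n) % n ≡ r
residue {r} q n r<n = trans ([m+kn]%n≡m%n r q n) (m<n⇒m%n≡m r<n)

quotient : ∀ {r} q n .{{_ : NonZero n}} → r < n → (r + q * n) / n ≡ q
quotient {r} q n r<n =
  trans (+-distrib-/-∣ʳ r (divides q refl)) (cong₂ _+_ (m<n⇒m/n≡0 r<n) (m*n/n≡m q n))

periodic : ∀ (π : ℕ → ℕ) n .{{_ : NonZero n}} x k → π ((x + k * n) % n) ≡ π (x % n)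
periodic π n x k = cong π ([m+kn]%n≡m%n x k n)

same-residue : ∀ (π : ℕ → ℕ) n .{{_ : NonZero n}} {x y} k → x ≡ y + k * n → π (x % n) ≡ π (y % n)
same-residue π n {y = y} k x≡y+kn = trans (cong (λ z → π (z % n)) x≡y+kn) (periodic π n y k)

regroup : ∀ r a c n m → r + a * n + c * (m * n) ≡ r + (a + c * m) * n
regroup = solve-∀

move-block : ∀ I e n x → I + e * n + x ≡ I + x + e * n
move-block = solve-∀

move-block₂ : ∀ I e n x y → I + e * n + x + y ≡ I + x + y + e * n
move-block₂ = solve-∀

by-parity : ∀ (π : ℕ → ℕ) n .{{_ : NonZero (2 * n)}} s t →
            π ((s + t * n) % (2 * n)) ≡ π ((s + (t % 2) * n) % (2 * n))
by-parity π n s t = begin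
  π ((s + t * n) % (2 * n))                                ≡⟨ cong (λ x → π ((s + x * n) % (2 * n))) (m≡m%n+[m/n]*n t 2) ⟩
  π ((s + (t % 2 + (t / 2) * 2) * n) % (2 * n))            ≡⟨ cong (λ x → π (x % (2 * n))) (sym (regroup s (t % 2) (t / 2) n 2)) ⟩
  π ((s + (t % 2) * n + (t / 2) * (2 * n)) % (2 * n))      ≡⟨ periodic π (2 * n) _ (t / 2) ⟩
  π ((s + (t % 2) * n) % (2 * n))                          ∎
  where open ≡-Reasoning

cap-exact : ∀ {x n} → x ⊓ n < n → x ⊓ n ≡ x
cap-exact {x} {n} lt with ⊓-sel x n
... | inj₁ x⊓n≡x = x⊓n≡x
... | inj₂ x⊓n≡n = contradiction (subst (_< n) x⊓n≡n lt) (n≮n n)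

above-cap : ∀ {c x n} → c < x → x ⊓ n ≤ c → n ≤ c
above-cap {c} {x} {n} c<x x⊓n≤c with ⊓-sel x n
... | inj₁ x⊓n≡x = contradiction (subst (_≤ c) x⊓n≡x x⊓n≤c) (<⇒≱ c<x)
... | inj₂ x⊓n≡n = subst (_≤ c) x⊓n≡n x⊓n≤c

record Capped (M n : ℕ) .{{_ : NonZero n}} (π : ℕ → ℕ) (w : Word) : Set where
  constructor capped
  field at : ∀ x → w x ⊓ M ≡ π (x % n)

capped-exact : ∀ {M n π w} .{{_ : NonZero n}} → Capped M n π w → ∀ x → π (x % n) < M → w x ≡ π (x % n)
capped-exact {M} (capped at) x below = trans (sym (cap-exact (subst (_< M) (sym (at x)) below))) (at x)

capped-shifted : ∀ {M n π w} .{{_ : NonZero n}} → Capped M n π w →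
                 ∀ x k → π (x % n) < M → w (x + k * n) ≡ π (x % n)
capped-shifted {M} {n} {π} cap x k below =
  trans (capped-exact cap (x + k * n) (subst (_< M) (sym (periodic π n x k)) below)) (periodic π n x k)

capped-periodic : ∀ {M n π w} .{{_ : NonZero n}} → Capped M n π w →
                  ∀ x k → π (x % n) < M → w x ≡ w (x + k * n)
capped-periodic cap x k below = trans (capped-exact cap x below) (sym (capped-shifted cap x k below))

recursive-index< : ∀ m → m % 10 ≡ 9 → 5 * ((m / 10) / 3) + 4 < m
recursive-index< m m%10≡9 = begin-strict
    5 * ((m / 10) / 3) + 4  ≤⟨ +-monoˡ-≤ 4 (*-monoʳ-≤ 5 (m/n≤m (m / 10) 3)) ⟩
    5 * (m / 10) + 4        <⟨ +-mono-≤-< (*-monoˡ-≤ (m / 10) 5≤10) (from-yes (4 <? 9)) ⟩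
    10 * (m / 10) + 9       ≡⟨ +-comm (10 * (m / 10)) 9 ⟩
    9 + 10 * (m / 10)       ≡⟨ cong₂ _+_ (sym m%10≡9) (*-comm 10 (m / 10)) ⟩
    m % 10 + m / 10 * 10    ≡⟨ sym (m≡m%n+[m/n]*n m 10) ⟩
    m                       ∎
  where
  open ≤-Reasoning
  5≤10 : 5 ≤ 10
  5≤10 = from-yes (5 ≤? 10)

step-local : ∀ g g' m → (∀ k → k < m → g k ≡ g' k) → step g m ≡ step g' m
step-local g g' m agree with m % 10 in eq | m%n<n m 10
... | 0 | _ = refl
... | 1 | _ = refl
... | 2 | _ = refl
... | 3 | _ = refl
... | 4 | _ = refl
... | 5 | _ = refl
... | 6 | _ = refl
... | 7 | _ = refl
... | 8 | _ = refl
... | 9 | _ with (m / 10) % 3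
...   | 0 = refl
...   | 1 = refl
...   | suc (suc _) = cong (_+ 2) (agree _ (recursive-index< m eq))
step-local g g' m agree | suc (suc (suc (suc (suc (suc (suc (suc (suc (suc _))))))))) | s≤s (s≤s (s≤s (s≤s (s≤s (s≤s (s≤s (s≤s (s≤s (s≤s ())))))))))

aFuel-stable : ∀ f f' m → m < f → m < f' → aFuel f m ≡ aFuel f' m
aFuel-stable (suc f) (suc f') m (s≤s m≤f) (s≤s m≤f') =
  step-local (aFuel f) (aFuel f') m λ k k<m → aFuel-stable f f' k (≤-trans k<m m≤f) (≤-trans k<m m≤f')

v-recurrence : ∀ m → v m ≡ step v m
v-recurrence m = step-local (aFuel m) v m λ k k<m → aFuel-stable m (suc k) k k<m ≤-refl

-- The capped pattern of v modulo 10: the letters at the small positions, and 3 at the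
-- positions 4 and 9, whose letters are at least 3.
shape : ℕ → ℕ
shape 0 = 0
shape 1 = 1
shape 2 = 2
shape 3 = 0
shape 5 = 1
shape 6 = 0
shape 7 = 2
shape 8 = 1
shape _ = 3

σ : Word
σ x = shape (x % 10)

step-small : ∀ g m → σ m < 3 → step g m ≡ σ m
step-small g m small with m % 10
... | 0 = refl
... | 1 = refl
... | 2 = refl
... | 3 = refl
... | 5 = refl
... | 6 = refl
... | 7 = refl
... | 8 = refl
step-small g m (s≤s (s≤s (s≤s ()))) | 4
step-small g m (s≤s (s≤s (s≤s ()))) | 9
step-small g m (s≤s (s≤s (s≤s ()))) | suc (suc (suc (suc (suc (suc (suc (suc (suc (suc _)))))))))

step-10n+4 : ∀ g m → m % 10 ≡ 4 → step g m ≡ 3 + (m / 10) % 2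
step-10n+4 g m m%10≡4 with m % 10
step-10n+4 g m refl | .4 with (m / 10) % 2 | m%n<n (m / 10) 2
... | 0 | _ = refl
... | 1 | _ = refl
... | suc (suc _) | s≤s (s≤s ())

step-10n+9 : ∀ g m → m % 10 ≡ 9 → (m / 10) % 3 < 2 → step g m ≡ 3 + (m / 10) % 3
step-10n+9 g m m%10≡9 low with m % 10
step-10n+9 g m refl low | .9 with (m / 10) % 3
... | 0 = refl
... | 1 = refl
step-10n+9 g m refl (s≤s (s≤s ())) | .9 | suc (suc _)

step-10n+9-rec : ∀ g m → m % 10 ≡ 9 → (m / 10) % 3 ≡ 2 → step g m ≡ g (5 * ((m / 10) / 3) + 4) + 2
step-10n+9-rec g m m%10≡9 n%3≡2 with m % 10
step-10n+9-rec g m refl n%3≡2 | .9 with (m / 10) % 3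
step-10n+9-rec g m refl refl | .9 | .2 = refl

v-10q+4 : ∀ q → v (4 + q * 10) ≡ 3 + q % 2
v-10q+4 q = begin
  v (4 + q * 10)                   ≡⟨ v-recurrence (4 + q * 10) ⟩
  step v (4 + q * 10)              ≡⟨ step-10n+4 v (4 + q * 10) (residue q 10 (from-yes (4 <? 10))) ⟩
  3 + ((4 + q * 10) / 10) % 2      ≡⟨ cong (λ n → 3 + n % 2) (quotient q 10 (from-yes (4 <? 10))) ⟩
  3 + q % 2                        ∎
  where open ≡-Reasoning

v-10q+9 : ∀ q → q % 3 < 2 → v (9 + q * 10) ≡ 3 + q % 3
v-10q+9 q low = begin
  v (9 + q * 10)                   ≡⟨ v-recurrence (9 + q * 10) ⟩
  step v (9 + q * 10)              ≡⟨ step-10n+9 v (9 + q * 10) (residue q 10 ≤-refl) (subst (λ n → n % 3 < 2) (sym n≡q) low) ⟩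
  3 + ((9 + q * 10) / 10) % 3      ≡⟨ cong (λ n → 3 + n % 3) n≡q ⟩
  3 + q % 3                        ∎
  where
  open ≡-Reasoning
  n≡q : (9 + q * 10) / 10 ≡ q
  n≡q = quotient q 10 ≤-refl

v-10q+9-rec : ∀ q → q % 3 ≡ 2 → v (9 + q * 10) ≡ v (4 + (q / 3) * 5) + 2
v-10q+9-rec q q%3≡2 = begin
  v (9 + q * 10)                              ≡⟨ v-recurrence (9 + q * 10) ⟩
  step v (9 + q * 10)                         ≡⟨ step-10n+9-rec v (9 + q * 10) (residue q 10 ≤-refl) (subst (λ n → n % 3 ≡ 2) (sym n≡q) q%3≡2) ⟩
  v (5 * (((9 + q * 10) / 10) / 3) + 4) + 2   ≡⟨ cong (λ n → v (5 * (n / 3) + 4) + 2) n≡q ⟩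
  v (5 * (q / 3) + 4) + 2                     ≡⟨ cong (λ n → v n + 2) (+-comm (5 * (q / 3)) 4) ⟩
  v (4 + 5 * (q / 3)) + 2                     ≡⟨ cong (λ n → v (4 + n) + 2) (*-comm 5 (q / 3)) ⟩
  v (4 + (q / 3) * 5) + 2                     ∎
  where
  open ≡-Reasoning
  n≡q : (9 + q * 10) / 10 ≡ q
  n≡q = quotient q 10 ≤-refl

v-small : ∀ x → σ x < 3 → v x ≡ σ x
v-small x small = trans (v-recurrence x) (step-small v x small)

opaque
  b : Word
  b k = v (4 + k * 5)

  b-def : ∀ k → b k ≡ v (4 + k * 5)
  b-def k = refl

  b-4t : ∀ t → b (t * 4) ≡ 3
  b-4t t = trans (cong v (pos t)) (trans (v-10q+4 (t * 2)) (cong (3 +_) (m*n%n≡0 t 2)))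
    where
    pos : ∀ t → 4 + t * 4 * 5 ≡ 4 + t * 2 * 10
    pos = solve-∀

  b-4t+2 : ∀ t → b (2 + t * 4) ≡ 4
  b-4t+2 t = trans (cong v (pos t)) (trans (v-10q+4 (1 + t * 2)) (cong (3 +_) (residue t 2 ≤-refl)))
    where
    pos : ∀ t → 4 + (2 + t * 4) * 5 ≡ 4 + (1 + t * 2) * 10
    pos = solve-∀

  b-6t+1 : ∀ t → b (1 + t * 6) ≡ 3
  b-6t+1 t = trans (cong v (pos t)) (trans (v-10q+9 (t * 3) (subst (_< 2) (sym t*3%3≡0) (s≤s z≤n))) (cong (3 +_) t*3%3≡0))
    where
    pos : ∀ t → 4 + (1 + t * 6) * 5 ≡ 9 + t * 3 * 10
    pos = solve-∀
    t*3%3≡0 : (t * 3) % 3 ≡ 0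
    t*3%3≡0 = m*n%n≡0 t 3

  b-6t+3 : ∀ t → b (3 + t * 6) ≡ 4
  b-6t+3 t = trans (cong v (pos t)) (trans (v-10q+9 (1 + t * 3) (subst (_< 2) (sym q%3≡1) ≤-refl)) (cong (3 +_) q%3≡1))
    where
    pos : ∀ t → 4 + (3 + t * 6) * 5 ≡ 9 + (1 + t * 3) * 10
    pos = solve-∀
    q%3≡1 : (1 + t * 3) % 3 ≡ 1
    q%3≡1 = residue t 3 (s≤s (s≤s z≤n))

  b-6t+5 : ∀ t → b (5 + t * 6) ≡ b t + 2
  b-6t+5 t = trans (cong v (pos t)) (trans (v-10q+9-rec (2 + t * 3) (residue t 3 ≤-refl))
                                           (cong (λ n → v (4 + n * 5) + 2) (quotient t 3 ≤-refl)))
    where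
    pos : ∀ t → 4 + (5 + t * 6) * 5 ≡ 9 + (2 + t * 3) * 10
    pos = solve-∀

-- The capped pattern of b, modulo 12; 5 stands for "at least 5".
typ : ℕ → ℕ
typ 0 = 3
typ 1 = 3
typ 2 = 4
typ 3 = 4
typ 4 = 3
typ 6 = 4
typ 7 = 3
typ 8 = 3
typ 9 = 4
typ 10 = 4
typ _ = 5

τ : Word
τ k = typ (k % 12)

τ≥3 : ∀ k → 3 ≤ τ k
τ≥3 k = from-yes (allUpTo? (λ R → 3 ≤? typ R) 12) (m%n<n k 12)

τ-inner : ∀ s t → s < 5 → τ (s + t * 6) < 5
τ-inner s t s<5 = subst (_< 5) (sym (by-parity typ 6 s t))
  (from-yes (allUpTo? (λ s → allUpTo? (λ e → τ (s + e * 6) <? 5) 2) 5) s<5 (m%n<n t 2))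

fixed : ∀ {k k' val} → k ≡ k' → b k' ≡ val → b k ⊓ 5 ≡ val ⊓ 5
fixed k≡k' b≡val = cong (_⊓ 5) (trans (cong b k≡k') b≡val)

raised : ∀ {k t} → k ≡ 5 + t * 6 → 3 ≤ b t → b k ⊓ 5 ≡ 5
raised {k} {t} k≡6t+5 3≤bt =
  trans (cong (λ n → b n ⊓ 5) k≡6t+5) (trans (cong (_⊓ 5) (b-6t+5 t)) (m≥n⇒m⊓n≡n (+-monoˡ-≤ 2 3≤bt)))

2≤12 : 2 ≤ 12
2≤12 = from-yes (2 ≤? 12)

b≥3-from : ∀ {k} → b k ⊓ 5 ≡ τ k → 3 ≤ b k
b≥3-from {k} b⊓5≡τ = ≤-trans (τ≥3 k) (subst (_≤ b k) b⊓5≡τ (m⊓n≤m (b k) 5))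

b-class : ∀ R c → R < 12 → (∀ y → y < R + c * 12 → 3 ≤ b y) → b (R + c * 12) ⊓ 5 ≡ typ R
b-class 0 c _ _ = fixed (regroup 0 0 c 4 3) (b-4t (c * 3))
b-class 1 c _ _ = fixed (regroup 1 0 c 6 2) (b-6t+1 (c * 2))
b-class 2 c _ _ = fixed (regroup 2 0 c 4 3) (b-4t+2 (c * 3))
b-class 3 c _ _ = fixed (regroup 3 0 c 6 2) (b-6t+3 (c * 2))
b-class 4 c _ _ = fixed (regroup 0 1 c 4 3) (b-4t (1 + c * 3))
b-class 5 c _ below = raised (regroup 5 0 c 6 2) (below (c * 2) (s≤s (≤-trans (*-monoʳ-≤ c 2≤12) (m≤n+m _ 4))))
b-class 6 c _ _ = fixed (regroup 2 1 c 4 3) (b-4t+2 (1 + c * 3))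
b-class 7 c _ _ = fixed (regroup 1 1 c 6 2) (b-6t+1 (1 + c * 2))
b-class 8 c _ _ = fixed (regroup 0 2 c 4 3) (b-4t (2 + c * 3))
b-class 9 c _ _ = fixed (regroup 3 1 c 6 2) (b-6t+3 (1 + c * 2))
b-class 10 c _ _ = fixed (regroup 2 2 c 4 3) (b-4t+2 (2 + c * 3))
b-class 11 c _ below = raised (regroup 5 1 c 6 2) (below (1 + c * 2) (s≤s (s≤s (≤-trans (*-monoʳ-≤ c 2≤12) (m≤n+m _ 9)))))
b-class (suc (suc (suc (suc (suc (suc (suc (suc (suc (suc (suc (suc _)))))))))))) c
  (s≤s (s≤s (s≤s (s≤s (s≤s (s≤s (s≤s (s≤s (s≤s (s≤s (s≤s (s≤s ())))))))))))) _

b-capped : Capped 5 12 typ b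
b-capped = capped (<-rec _ λ k rec → by-class k (blocks 12 k) λ y y<k → b≥3-from (rec y<k))
  where
  by-class : ∀ k → Block 12 k → (∀ y → y < k → 3 ≤ b y) → b k ⊓ 5 ≡ τ k
  by-class .(R + c * 12) (block R c R<12) below =
    trans (b-class R c R<12 below) (sym (cong typ (residue c 12 R<12)))

b≥3 : ∀ k → 3 ≤ b k
b≥3 k = b≥3-from (Capped.at b-capped k)

σ-inner : ∀ s t → s < 4 → σ (s + t * 5) < 3
σ-inner s t s<4 = subst (_< 3) (sym (by-parity shape 5 s t))
  (from-yes (allUpTo? (λ s → allUpTo? (λ e → σ (s + e * 5) <? 3) 2) 4) s<4 (m%n<n t 2))

σ-last : ∀ t → σ (4 + t * 5) ≡ 3
σ-last t = trans (by-parity shape 5 4 t) (from-yes (allUpTo? (λ e → σ (4 + e * 5) ≟ 3) 2) (m%n<n t 2))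

v-capped : Capped 3 10 shape v
v-capped = capped λ x → by-block x (blocks 5 x)
  where
  by-block : ∀ x → Block 5 x → v x ⊓ 3 ≡ σ x
  by-block .(s + t * 5) (block s t s<5) with m≤n⇒m<n∨m≡n (s≤s⁻¹ s<5)
  ... | inj₁ s<4 = trans (cong (_⊓ 3) (v-small (s + t * 5) small)) (m≤n⇒m⊓n≡m (<⇒≤ small))
    where
    small : σ (s + t * 5) < 3
    small = σ-inner s t s<4
  ... | inj₂ refl = trans (m≥n⇒m⊓n≡n (subst (3 ≤_) (b-def t) (b≥3 t))) (sym (σ-last t))

σ≤3 : ∀ k → σ k ≤ 3
σ≤3 k = subst (_≤ 3) (Capped.at v-capped k) (m⊓n≤n (v k) 3)

-- Repeats w i W d: each of the W letters of w from position i reappears d positions later.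
-- By definition, HasPeriod w i L p is Repeats w i (L ∸ p) p.
Repeats : Word → ℕ → ℕ → ℕ → Set
Repeats w i W d = ∀ j → j < W → w (i + j) ≡ w (i + j + d)

shorten : ∀ {w i W W' d} → W' ≤ W → Repeats w i W d → Repeats w i W' d
shorten W'≤W rep j j<W' = rep j (≤-trans j<W' W'≤W)

record Layered (w u : Word) (f : ℕ → ℕ) (m : ℕ) : Set where
  field
    last  : ∀ t → w (m + t * suc m) ≡ f (u t)
    inner : ∀ s t k → s < m → w (s + t * suc m) ≡ w (s + t * suc m + k * (2 * suc m))

v-layered : Layered v b id 4
v-layered = record
  { last  = λ t → sym (b-def t)
  ; inner = λ s t k s<4 → capped-periodic v-capped (s + t * 5) k (σ-inner s t s<4)
  }

b-layered : Layered b b (_+ 2) 5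
b-layered = record
  { last  = b-6t+5
  ; inner = λ s t k s<5 → capped-periodic b-capped (s + t * 6) k (τ-inner s t s<5)
  }

offset : ∀ r d a t n → r + a * n + (d + t * n) ≡ (r + d) + (a + t) * n
offset = solve-∀

offset-shifted : ∀ r d a t n e → r + a * n + (d + t * n) + e * n ≡ (r + d) + (a + t + e) * n
offset-shifted = solve-∀

restrict : ∀ {w u f m} → Layered w u f m → (∀ {x y} → f x ≡ f y → x ≡ y) →
           ∀ {r a Q P} → r ≤ m → Repeats w (r + a * suc m) (Q * suc m) (P * suc m) → Repeats u a Q P
restrict {w} {u} {f} {m} layered f-inj {r} {a} {Q} {P} r≤m rep t t<Q = f-inj (begin
    f (u (a + t))                        ≡⟨ last (a + t) ⟨
    w (m + (a + t) * suc m)              ≡⟨ cong w block-end ⟨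
    w (r + a * suc m + j)                ≡⟨ rep j j<Q*n ⟩
    w (r + a * suc m + j + P * suc m)    ≡⟨ cong w shifted-block-end ⟩
    w (m + (a + t + P) * suc m)          ≡⟨ last (a + t + P) ⟩
    f (u (a + t + P))                    ∎)
  where
  open Layered layered
  open ≡-Reasoning
  -- j is the offset of the end of block a + t from the start r + a (suc m) of the window
  j : ℕ
  j = (m ∸ r) + t * suc m
  j<Q*n : j < Q * suc m
  j<Q*n = ≤-trans (s≤s (+-monoˡ-≤ (t * suc m) (m∸n≤m m r))) (*-monoˡ-≤ (suc m) t<Q)
  r+[m∸r]≡m : r + (m ∸ r) ≡ m
  r+[m∸r]≡m = m+[n∸m]≡n r≤m
  block-end : r + a * suc m + j ≡ m + (a + t) * suc m
  block-end = trans (offset r (m ∸ r) a t (suc m)) (cong (_+ (a + t) * suc m) r+[m∸r]≡m)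
  shifted-block-end : r + a * suc m + j + P * suc m ≡ m + (a + t + P) * suc m
  shifted-block-end = trans (offset-shifted r (m ∸ r) a t (suc m) P) (cong (_+ (a + t + P) * suc m) r+[m∸r]≡m)

shift-swap : ∀ Q n → 2 * Q * n ≡ Q * (2 * n)
shift-swap = solve-∀

lift : ∀ {w u f m} → Layered w u f m → ∀ {I h Q} → Repeats u I h (2 * Q) →
       Repeats w (I * suc m) (m + h * suc m) (Q * (2 * suc m))
lift {w} {u} {f} {m} layered {I} {h} {Q} rep j j<W = by-block j (blocks (suc m) j) j<W
  where
  open Layered layered
  open ≡-Reasoning
  n : ℕ
  n = suc m
  by-block : ∀ j → Block n j → j < m + h * n → w (I * n + j) ≡ w (I * n + j + Q * (2 * n))
  by-block .(s + t * n) (block s t s<n) j<W with m≤n⇒m<n∨m≡n (s≤s⁻¹ s<n)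
  ... | inj₁ s<m = begin
    w (I * n + (s + t * n))                    ≡⟨ cong w (offset 0 s I t n) ⟩
    w (s + (I + t) * n)                        ≡⟨ inner s (I + t) Q s<m ⟩
    w (s + (I + t) * n + Q * (2 * n))          ≡⟨ cong (λ x → w (x + Q * (2 * n))) (offset 0 s I t n) ⟨
    w (I * n + (s + t * n) + Q * (2 * n))      ∎
  ... | inj₂ refl = begin
    w (I * n + (m + t * n))                    ≡⟨ cong w (offset 0 m I t n) ⟩
    w (m + (I + t) * n)                        ≡⟨ last (I + t) ⟩
    f (u (I + t))                              ≡⟨ cong f (rep t t<h) ⟩
    f (u (I + t + 2 * Q))                      ≡⟨ last (I + t + 2 * Q) ⟨
    w (m + (I + t + 2 * Q) * n)                ≡⟨ cong w (offset-shifted 0 m I t n (2 * Q)) ⟨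
    w (I * n + (m + t * n) + 2 * Q * n)        ≡⟨ cong (λ x → w (I * n + (m + t * n) + x)) (shift-swap Q n) ⟩
    w (I * n + (m + t * n) + Q * (2 * n))      ∎
    where
    t<h : t < h
    t<h = *-cancelʳ-< n t h (+-cancelˡ-< m (t * n) (h * n) j<W)

opaque
  even-period-table : ∀ {R} → R < 12 → ∀ {Q} → Q < 5 →
                      ∃ λ j → j < 2 × j < suc Q × τ (R + j) ≢ τ (R + j + 2 * suc Q)
  even-period-table = from-yes (allUpTo? (λ R → allUpTo? (λ Q → anyUpTo? (λ j →
    (j <? suc Q) ×-dec ¬? (τ (R + j) ≟ τ (R + j + 2 * suc Q))) 2) 5) 12)

-- b has no factor of length 3q with period 2q, i.e. no 3/2-power of even period.
b-no-even-powers : ∀ q I → 1 ≤ q → ¬ Repeats b I q (2 * q)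
b-no-even-powers = <-rec _ λ q rec → by-period q (blocks 6 q) rec
  where
  by-period : ∀ q → Block 6 q → (∀ {q'} → q' < q → ∀ I → 1 ≤ q' → ¬ Repeats b I q' (2 * q')) →
              ∀ I → 1 ≤ q → ¬ Repeats b I q (2 * q)
  by-period .(0 + 0 * 6) (block 0 0 _) rec I () rep
  -- q = 6(s+1): the letters at the positions ≡ 5 (mod 6) are those of b raised by 2, and
  -- carry a repetition of length s+1 with shift 2(s+1).
  by-period .(0 + suc s * 6) (block 0 (suc s) _) rec I _ rep with blocks 6 I
  ... | block R c R<6 = rec (m<m*n (suc s) 6 (s≤s (s≤s z≤n))) c (s≤s z≤n)
          (restrict b-layered (+-cancelʳ-≡ 2 _ _) (s≤s⁻¹ R<6)
            (subst (Repeats b (R + c * 6) (suc s * 6)) (sym (*-assoc 2 (suc s) 6)) rep))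
  -- q ≢ 0 (mod 6): the capped classes of b contradict the repetition.
  by-period .(suc Q + s * 6) (block (suc Q) s Q<6) rec I _ rep with blocks 12 I
  ... | block R c R<12 with even-period-table R<12 (s≤s⁻¹ Q<6)
  ...   | j , _ , j≤Q , classes-differ = classes-differ (begin
    τ (R + j)                                       ≡⟨ same-residue typ 12 c (move-block R c 12 j) ⟨
    τ (R + c * 12 + j)                              ≡⟨ Capped.at b-capped _ ⟨
    b (R + c * 12 + j) ⊓ 5                          ≡⟨ cong (_⊓ 5) (rep j (≤-trans j≤Q (m≤m+n (suc Q) (s * 6)))) ⟩
    b (R + c * 12 + j + 2 * (suc Q + s * 6)) ⊓ 5    ≡⟨ Capped.at b-capped _ ⟩
    τ (R + c * 12 + j + 2 * (suc Q + s * 6))        ≡⟨ same-residue typ 12 (c + s) (window-end R c j Q s) ⟩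
    τ (R + j + 2 * suc Q)                           ∎)
    where
    open ≡-Reasoning
    window-end : ∀ R c j Q s → R + c * 12 + j + 2 * (suc Q + s * 6) ≡ R + j + 2 * suc Q + (c + s) * 12
    window-end = solve-∀

half-period : ∀ p L → 3 * p ≤ 2 * L → p ≤ 2 * (L ∸ p)
half-period p L 3p≤2L = begin
  p                  ≡⟨ m+n∸n≡m p (2 * p) ⟨
  p + 2 * p ∸ 2 * p  ≤⟨ ∸-monoˡ-≤ (2 * p) (subst (_≤ 2 * L) (three p) 3p≤2L) ⟩
  2 * L ∸ 2 * p      ≡⟨ *-distribˡ-∸ 2 L p ⟨
  2 * (L ∸ p)        ∎
  where
  open ≤-Reasoning
  three : ∀ p → 3 * p ≡ p + 2 * p
  three = solve-∀

opaque
  period-table : ∀ {r} → r < 10 → ∀ {d} → d < 9 →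
                 ∃ λ j → j < 5 × 2 * j < suc d × σ (r + j) ≢ σ (r + j + suc d)
  period-table = from-yes (allUpTo? (λ r → allUpTo? (λ d → anyUpTo? (λ j →
    (2 * j <? suc d) ×-dec ¬? (σ (r + j) ≟ σ (r + j + suc d))) 5) 9) 10)

v-avoids : Avoids32 v
v-avoids i L (p , 1≤p , 3p≤2L , periodic-v) =
  by-period i (blocks 10 p) 1≤p (half-period p L 3p≤2L) periodic-v
  where
  by-period : ∀ i {p} → Block 10 p → 1 ≤ p → p ≤ 2 * (L ∸ p) → Repeats v i (L ∸ p) p → ⊥
  by-period i (block 0 0 _) () _ _
  -- p = 10(q+1): restricted to the positions ≡ 4 (mod 5), the repetition is an even
  -- 3/2-power of b.
  by-period i (block 0 (suc q) _) _ compared rep with blocks 5 i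
  ... | block r a r<5 =
    b-no-even-powers (suc q) a (s≤s z≤n) (restrict v-layered id (s≤s⁻¹ r<5)
      (subst (Repeats v (r + a * 5) (suc q * 5)) (ten-blocks q) (shorten {w = v} {i = r + a * 5} half-compared rep)))
    where
    ten-blocks : ∀ q → suc q * 10 ≡ 2 * suc q * 5
    ten-blocks = solve-∀
    half-compared : suc q * 5 ≤ L ∸ suc q * 10
    half-compared = *-cancelˡ-≤ 2 (subst (_≤ 2 * (L ∸ suc q * 10)) (trans (ten-blocks q) (*-assoc 2 (suc q) 5)) compared)
  -- p ≢ 0 (mod 10): the capped pattern σ contradicts the repetition.
  by-period i (block (suc d) q d<10) _ compared rep with blocks 10 i
  ... | block r a r<10 with period-table r<10 (s≤s⁻¹ d<10)
  ...   | j , _ , 2j<d , shapes-differ = shapes-differ (begin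
    σ (r + j)                                    ≡⟨ same-residue shape 10 a (move-block r a 10 j) ⟨
    σ (r + a * 10 + j)                           ≡⟨ Capped.at v-capped (r + a * 10 + j) ⟨
    v (r + a * 10 + j) ⊓ 3                       ≡⟨ cong (_⊓ 3) (rep j j<L∸p) ⟩
    v (r + a * 10 + j + (suc d + q * 10)) ⊓ 3    ≡⟨ Capped.at v-capped (r + a * 10 + j + (suc d + q * 10)) ⟩
    σ (r + a * 10 + j + (suc d + q * 10))        ≡⟨ same-residue shape 10 (a + q) (window-end r a j d q) ⟩
    σ (r + j + suc d)                            ∎)
    where
    open ≡-Reasoning
    j<L∸p : j < L ∸ (suc d + q * 10)
    j<L∸p = *-cancelˡ-< 2 j _ (≤-trans 2j<d (≤-trans (m≤m+n (suc d) (q * 10)) compared))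
    window-end : ∀ r a j d q → r + a * 10 + j + (suc d + q * 10) ≡ r + j + suc d + (a + q) * 10
    window-end = solve-∀

-- NearPower u k c: the factor u[start .. k] would be a 3/2-power of the given period
-- if its last letter, at position k, were c.
record NearPower (u : Word) (k c : ℕ) : Set where
  constructor near-power
  field
    start period span : ℕ
    ends     : start + period + span ≡ k
    nonempty : 1 ≤ period
    long     : 3 * period ≤ 2 * (period + suc span)
    repeats  : Repeats u start span period
    closes   : u (start + span) ≡ c

completes : ∀ {u w k c} → NearPower u k c → (∀ j → j < k → w j ≡ u j) → w k ≡ c → ¬ Avoids32 w
completes {u} {w} {k} {c} (near-power i d W ends 1≤d long rep closes) agree wk≡c avoids =
  avoids i (d + suc W) (d , 1≤d , long , periodic-w)
  where
  open ≡-Reasoning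
  swap : ∀ i j d → i + j + d ≡ i + d + j
  swap = solve-∀
  periodic-w : HasPeriod w i (d + suc W) d
  periodic-w j j<L∸d with m≤n⇒m<n∨m≡n (s≤s⁻¹ (subst (j <_) (m+n∸m≡n d (suc W)) j<L∸d))
  ... | inj₁ j<W = begin
    w (i + j)       ≡⟨ agree (i + j) (subst (i + j <_) ends (<-≤-trans (+-monoʳ-< i j<W) (+-monoˡ-≤ W (m≤m+n i d)))) ⟩
    u (i + j)       ≡⟨ rep j j<W ⟩
    u (i + j + d)   ≡⟨ agree (i + j + d) (subst₂ _<_ (sym (swap i j d)) ends (+-monoʳ-< (i + d) j<W)) ⟨
    w (i + j + d)   ∎
  ... | inj₂ refl = begin
    w (i + W)       ≡⟨ agree (i + W) (subst (i + W <_) ends (+-monoˡ-< W (m<m+n i 1≤d))) ⟩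
    u (i + W)       ≡⟨ closes ⟩
    c               ≡⟨ wk≡c ⟨
    w k             ≡⟨ cong w (trans (sym ends) (swap i d W)) ⟩
    w (i + W + d)   ∎

record EvenNearPower (u : Word) (k c : ℕ) : Set where
  constructor even-near-power
  field
    start half : ℕ
    ends    : start + 3 * suc half ≡ suc k
    repeats : Repeats u start half (2 * suc half)
    closes  : u (start + half) ≡ c

even-near : ∀ {u k c} → EvenNearPower u k c → NearPower u k c
even-near (even-near-power I h ends rep closes) =
  near-power I (2 * suc h) h (suc-injective (trans (length I h) ends)) (s≤s z≤n) (≤-reflexive (thirds h)) rep closes
  where
  length : ∀ I h → suc (I + 2 * suc h + h) ≡ I + 3 * suc h
  length = solve-∀
  thirds : ∀ h → 3 * (2 * suc h) ≡ 2 * (2 * suc h + suc h)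
  thirds = solve-∀

lift-near : ∀ {w u f m K c} → Layered w u f m → EvenNearPower u K c → EvenNearPower w (m + K * suc m) (f c)
lift-near {w} {u} {f} {m} {K} {c} layered (even-near-power I h ends rep closes) =
  even-near-power (I * suc m) (m + h * suc m)
    (trans (scaled-length I m h) (cong (_* suc m) ends))
    (subst (Repeats w (I * suc m) (m + h * suc m)) (scaled-shift h m) (lift layered rep))
    (trans (cong w (offset 0 m I h (suc m))) (trans (Layered.last layered (I + h)) (cong f closes)))
  where
  scaled-length : ∀ I m h → I * suc m + 3 * suc (m + h * suc m) ≡ (I + 3 * suc h) * suc m
  scaled-length = solve-∀
  scaled-shift : ∀ h m → suc h * (2 * suc m) ≡ 2 * suc (m + h * suc m)
  scaled-shift = solve-∀

-- An even near-power of the pattern τ ending at R with last letter c, using only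
-- determined letters (τ < 5), starting at I = R + 1 − 3(h+1).
LocalEven : ℕ → ℕ → ℕ → Set
LocalEven R c h = (I + 3 * suc h ≡ suc R)
                × (∀ {j} → j < h → τ (I + j) < 5 × τ (I + j) ≡ τ (I + j + 2 * suc h))
                × τ (I + h) ≡ c
  where
  I : ℕ
  I = suc R ∸ 3 * suc h

opaque
  even-local-table : ∀ {R} → R < 12 → ∀ {c} → c < 5 → 3 ≤ c → c < typ R → ∃ λ h → h < 2 × LocalEven R c h
  even-local-table = from-yes (allUpTo? (λ R → allUpTo? (λ c → (3 ≤? c) →-dec (c <? typ R) →-dec
    anyUpTo? (λ h → let I = suc R ∸ 3 * suc h in
      (I + 3 * suc h ≟ suc R)
      ×-dec allUpTo? (λ j → (τ (I + j) <? 5) ×-dec (τ (I + j) ≟ τ (I + j + 2 * suc h))) h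
      ×-dec (τ (I + h) ≟ c)) 2) 5) 12)

b-near-local : ∀ K c → 3 ≤ c → c < 5 → c < τ K → EvenNearPower b K c
b-near-local K c 3≤c c<5 c<τK with blocks 12 K
... | block R e R<12 with even-local-table R<12 c<5 3≤c (subst (c <_) (cong typ (residue e 12 R<12)) c<τK)
...   | h , _ , ends , rep , closes =
  even-near-power (I + e * 12) h
    (trans (move-block I e 12 (3 * suc h)) (cong (_+ e * 12) ends))
    repeats
    (trans (cong b (move-block I e 12 h)) (trans (capped-shifted b-capped (I + h) e (subst (_< 5) (sym closes) c<5)) closes))
  where
  open ≡-Reasoning
  I : ℕ
  I = suc R ∸ 3 * suc h
  repeats : Repeats b (I + e * 12) h (2 * suc h)
  repeats j j<h = begin
    b (I + e * 12 + j)                ≡⟨ cong b (move-block I e 12 j) ⟩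
    b (I + j + e * 12)                ≡⟨ capped-shifted b-capped (I + j) e small ⟩
    τ (I + j)                         ≡⟨ same ⟩
    τ (I + j + 2 * suc h)             ≡⟨ capped-shifted b-capped (I + j + 2 * suc h) e (subst (_< 5) same small) ⟨
    b (I + j + 2 * suc h + e * 12)    ≡⟨ cong b (move-block₂ I e 12 j (2 * suc h)) ⟨
    b (I + e * 12 + j + 2 * suc h)    ∎
    where
    small : τ (I + j) < 5
    small = proj₁ (rep j<h)
    same : τ (I + j) ≡ τ (I + j + 2 * suc h)
    same = proj₂ (rep j<h)

b-near : ∀ K c → 3 ≤ c → c < b K → EvenNearPower b K c
b-near = <-rec _ λ K rec c 3≤c c<bK → case K (blocks 6 K) rec c 3≤c c<bK
  where
  case : ∀ K → Block 6 K → (∀ {K'} → K' < K → ∀ c → 3 ≤ c → c < b K' → EvenNearPower b K' c) →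
         ∀ c → 3 ≤ c → c < b K → EvenNearPower b K c
  case K _ rec c 3≤c c<bK with c <? 5
  ... | yes c<5 = b-near-local K c 3≤c c<5 (subst (c <_) (Capped.at b-capped K) (⊓-glb c<bK c<5))
  case .(s + t * 6) (block s t s<6) rec c 3≤c c<bK | no c≮5 with m≤n⇒m<n∨m≡n (s≤s⁻¹ s<6)
  -- inside a block of six, b is below 5
  ... | inj₁ s<5 = contradiction (<-trans c<bK (subst (_< 5) (sym (capped-exact b-capped (s + t * 6) τ<5)) τ<5)) c≮5
    where
    τ<5 : τ (s + t * 6) < 5
    τ<5 = τ-inner s t s<5
  -- at a block end, b = b t + 2: complete c − 2 in b ending at t, and lift
  ... | inj₂ refl = subst (EvenNearPower b (5 + t * 6)) (m∸n+n≡m 2≤c)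
          (lift-near b-layered (rec t<K (c ∸ 2) (∸-monoˡ-≤ 2 5≤c) c∸2<bt))
    where
    5≤c : 5 ≤ c
    5≤c = ≮⇒≥ c≮5
    2≤c : 2 ≤ c
    2≤c = ≤-trans (s≤s (s≤s z≤n)) 5≤c
    t<K : t < 5 + t * 6
    t<K = s≤s (≤-trans (m≤m*n t 6) (m≤n+m (t * 6) 4))
    c∸2<bt : c ∸ 2 < b t
    c∸2<bt = +-cancelʳ-< 2 (c ∸ 2) (b t) (subst₂ _<_ (sym (m∸n+n≡m 2≤c)) (b-6t+5 t) c<bK)

LocalNear : ℕ → ℕ → ℕ → ℕ → Set
LocalNear r c i d = (i + d + W ≡ r) × (1 ≤ d) × (3 * d ≤ 2 * (d + suc W))
                  × (∀ {j} → j < W → σ (i + j) < 3 × σ (i + j) ≡ σ (i + j + d))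
                  × σ (i + W) ≡ c
  where
  W : ℕ
  W = r ∸ (i + d)

opaque
  near-local-table : ∀ {r} → r < 10 → ∀ {c} → c < 3 → c < shape r →
                     ∃ λ i → i < suc r × ∃ λ d → d < suc r × LocalNear r c i d
  near-local-table = from-yes (allUpTo? (λ r → allUpTo? (λ c → (c <? shape r) →-dec
    anyUpTo? (λ i → anyUpTo? (λ d → let W = r ∸ (i + d) in
      (i + d + W ≟ r) ×-dec (1 ≤? d) ×-dec (3 * d ≤? 2 * (d + suc W))
      ×-dec allUpTo? (λ j → (σ (i + j) <? 3) ×-dec (σ (i + j) ≟ σ (i + j + d))) W
      ×-dec (σ (i + W) ≟ c)) (suc r)) (suc r)) 3) 10)

v-near-local : ∀ k c → c < σ k → NearPower v k c
v-near-local k c c<σk = by-block k (blocks 10 k) c<σk (<-≤-trans c<σk (σ≤3 k))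
  where
  by-block : ∀ k → Block 10 k → c < σ k → c < 3 → NearPower v k c
  by-block .(r + n * 10) (block r n r<10) c<σk c<3
    with near-local-table r<10 c<3 (subst (c <_) (cong shape (residue n 10 r<10)) c<σk)
  ... | i , _ , d , _ , ends , 1≤d , long , rep , closes =
    near-power (i + n * 10) d W
      (trans (move-block₂ i n 10 d W) (cong (_+ n * 10) ends)) 1≤d long repeats
      (trans (cong v (move-block i n 10 W)) (trans (capped-shifted v-capped (i + W) n (subst (_< 3) (sym closes) c<3)) closes))
    where
    open ≡-Reasoning
    W : ℕ
    W = r ∸ (i + d)
    repeats : Repeats v (i + n * 10) W d
    repeats j j<W = begin
      v (i + n * 10 + j)          ≡⟨ cong v (move-block i n 10 j) ⟩
      v (i + j + n * 10)          ≡⟨ capped-shifted v-capped (i + j) n small ⟩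
      σ (i + j)                   ≡⟨ same ⟩
      σ (i + j + d)               ≡⟨ capped-shifted v-capped (i + j + d) n (subst (_< 3) same small) ⟨
      v (i + j + d + n * 10)      ≡⟨ cong v (move-block₂ i n 10 j d) ⟨
      v (i + n * 10 + j + d)      ∎
      where
      small : σ (i + j) < 3
      small = proj₁ (rep j<W)
      same : σ (i + j) ≡ σ (i + j + d)
      same = proj₂ (rep j<W)

-- Every letter c < v k completes a near-power of v ending at k: small letters inside the
-- block of 10, letters ≥ 3 (only possible at positions 5t + 4) by lifting from b.
v-near : ∀ k c → c < v k → NearPower v k c
v-near k c c<vk with c <? σ k
... | yes c<σk = v-near-local k c c<σk
... | no c≮σk = by-block k (blocks 5 k) c<vk
  where
  3≤c : 3 ≤ c
  3≤c = above-cap c<vk (subst (_≤ c) (sym (Capped.at v-capped k)) (≮⇒≥ c≮σk))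
  by-block : ∀ k → Block 5 k → c < v k → NearPower v k c
  by-block .(s + t * 5) (block s t s<5) c<vk with m≤n⇒m<n∨m≡n (s≤s⁻¹ s<5)
  ... | inj₁ s<4 = contradiction (<-trans c<vk (subst (_< 3) (sym (v-small (s + t * 5) σ<3)) σ<3)) (≤⇒≯ 3≤c)
    where
    σ<3 : σ (s + t * 5) < 3
    σ<3 = σ-inner s t s<4
  ... | inj₂ refl = even-near (lift-near v-layered (b-near t c 3≤c (subst (c <_) (sym (b-def t)) c<vk)))

-- Second half of the theorem: a word below v agrees with v up to some k and has a smaller
-- letter there, which completes a near-power of v into a 3/2-power.
v-least : (w : Word) → Avoids32 w → ¬ (w <lex v)
v-least w avoids (k , agree , wk<vk) = completes (v-near k (w k) wk<vk) agree refl avoids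

mainTheorem1 : Avoids32 v × ((w : Word) → Avoids32 w → ¬ (w <lex v))
mainTheorem1 = v-avoids , v-least
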